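{- Let $N$ be an odd prime and let $D \neq 1$ be a square-free integer such that the Legendre symbol satisfies $\left(\frac{D}{N}\right) = -1$. Write $N + 1 = 2^s u$ with $u$ odd and $s \ge 1$. Then for every $w \in \mathcal{G}_N(D) \setminus \{1, -1\}$, one of the following holds: (a) $w^u \equiv 1 \pmod N$; (b) $w^{2^r u} \equiv -1 \pmod N$ for some integer $0 \le r < s$.
   Context: For an integer $n \ge 2$ and square-free $D \neq 1$: if $D \equiv 2,3 \pmod 4$, let $\mathcal{I}_n(D) = \{a + b\sqrt{D} : a,b \in \mathbb{Z}/n\mathbb{Z}\}$ (the ring $\mathbb{Z}[\sqrt D]/n\mathbb{Z}[\sqrt D]$) and $\mathcal{G}_n(D) = \{a + b\sqrt{D} \in \mathcal{I}_n(D) : a^2 - Db^2 \equiv 1 \pmod n\}$. If $D \equiv 1 \pmod 4$, let $\omega = \frac{1+\sqrt D}{2}$, $\mathcal{I}_n(D) = \{a + b\omega : a,b \in \mathbb{Z}/n\mathbb{Z}\}$ (the ring $\mathbb{Z}[\omega]/n\mathbb{Z}[\omega]$) and $\mathcal{G}_n(D) = \{a + b\omega \in \mathcal{I}_n(D) : a^2 + ab + \frac{1-D}{4} b^2 \equiv 1 \pmod n\}$. $\mathcal{G}_n(D)$ is a group under the multiplication of $\mathcal{I}_n(D)$. A congruence $x \equiv y \pmod n$ between elements of $\mathcal{I}_n(D)$ means $x = y$ in $\mathcal{I}_n(D)$. -}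

module Defs where

open import Data.Nat as ℕ using (ℕ; zero; suc)
open import Data.Integer as ℤ using (ℤ; +_; _+_; _-_; _*_; -_; _%ℕ_; _/ℕ_)
open import Data.Integer.Divisibility using (_∣_)
open import Data.Product using (_×_; _,_; ∃; ∃-syntax)
open import Data.Bool using (Bool; true; false; if_then_else_)
open import Relation.Binary.PropositionalEquality using (_≡_)
open import Relation.Nullary using (¬_)

infix 4 _≡ᵢ_[mod_] _≈_[mod_]
_≡ᵢ_[mod_] : ℤ → ℤ → ℕ → Set
x ≡ᵢ y [mod n ] = (+ n) ∣ (x - y)

SquareFree : ℤ → Set
SquareFree D = (k : ℤ) → (k * k) ∣ D → ℤ.∣ k ∣ ≡ 1

LegendreMinusOne : ℤ → ℕ → Set
LegendreMinusOne D p = ¬ ((+ p) ∣ D) × ¬ (∃ λ (x : ℤ) → x * x ≡ᵢ D [mod p ])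

isOneMod4 : ℤ → Bool
isOneMod4 D with D %ℕ 4
... | 1 = true
... | _ = false

-- Elements of I_n(D), represented by integer coordinates (a , b):
--   a + b√D          if D ≡ 2,3 (mod 4)
--   a + bω, ω=(1+√D)/2 if D ≡ 1 (mod 4)
-- Equality in I_n(D) is coordinatewise congruence mod n.
Elt : Set
Elt = ℤ × ℤ

_≈_[mod_] : Elt → Elt → ℕ → Set
(a , b) ≈ (c , d) [mod n ] = (a ≡ᵢ c [mod n ]) × (b ≡ᵢ d [mod n ])

one : Elt
one = (+ 1 , + 0)

minusOne : Elt
minusOne = (- + 1 , + 0)

-- Multiplication in Z[√D] resp. Z[ω] (ω² = ω + (D-1)/4); reduces to
-- the multiplication of I_n(D) modulo n.
mul : ℤ → Elt → Elt → Elt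
mul D (a , b) (c , d) =
  if isOneMod4 D
  then (a * c + ((D - + 1) /ℕ 4) * (b * d) , a * d + b * c + b * d)
  else (a * c + D * (b * d) , a * d + b * c)

pow : ℤ → Elt → ℕ → Elt
pow D w zero = one
pow D w (suc k) = mul D w (pow D w k)

norm : ℤ → Elt → ℤ
norm D (a , b) =
  if isOneMod4 D
  then a * a + a * b + ((+ 1 - D) /ℕ 4) * (b * b)
  else a * a - D * (b * b)

InG : ℕ → ℤ → Elt → Set
InG n D w = norm D w ≡ᵢ + 1 [mod n ]

module Submission where

-- Write the ring as ℤ[θ] with θ² = α + βθ; its discriminant Δ = β² + 4α is 4D or D, hence
-- a non-residue mod N. Euler's criterion (proved, like Wilson's theorem, by pairing each
-- residue x with a/x) gives Δ^((N−1)/2) ≡ −1, so δ = 2θ − β satisfies δ^N = −δ and the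
-- Frobenius x ↦ x^N of ℤ[θ]/N is conjugation. Hence w^(N+1) = w w̄ = Nm(w) = 1. Moreover
-- ±1 are the only square roots of 1 in ℤ[θ]/N, so in w^u, w^(2u), …, w^(2^s u) = 1 the last
-- term different from 1, if there is one, is −1.

open import Algebra.Bundles using (Semiring; CommutativeSemiring)
open import Algebra.Structures using (IsCommutativeMonoid; IsCommutativeSemiring)
import Algebra.Structures.Biased as Biased
open import Data.Bool using (true; false)
open import Data.Empty using (⊥-elim)
open import Data.Fin as Fin using (Fin; toℕ; fromℕ; inject₁)
import Data.Fin.Properties as Fin
open import Data.Integer as ℤ using (ℤ; +_; _%ℕ_)
import Data.Integer.DivMod as ℤ
import Data.Integer.Divisibility.Signed as ℤ∣
import Data.Integer.Properties as ℤ
open import Data.Integer.Tactic.RingSolver using (solve-∀)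
open import Data.List using (List; []; _∷_; _++_; [_]; length; applyUpTo)
open import Data.List.Membership.Propositional using (_∈_)
open import Data.List.Membership.Propositional.Properties using (∈-∃++; ∈-applyUpTo⁺; ∈-applyUpTo⁻)
open import Data.List.Properties using (applyUpTo-∷ʳ; length-applyUpTo)
open import Data.List.Relation.Binary.Permutation.Propositional using (_↭_; prep; ↭-sym; ↭⇒↭ₛ)
open import Data.List.Relation.Binary.Permutation.Propositional.Properties
  using (All-resp-↭; ∈-resp-↭; ↭-length; shift)
import Data.List.Relation.Binary.Permutation.Setoid.Properties as ↭ₛ
open import Data.List.Relation.Unary.All as All using (All)
import Data.List.Relation.Unary.AllPairs as AllPairs
open import Data.List.Relation.Unary.Any using (here; there)
open import Data.List.Relation.Unary.Unique.Propositional using (Unique)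
open import Data.List.Relation.Unary.Unique.Propositional.Properties using (applyUpTo⁺₁)
open import Data.Nat as ℕ using (ℕ; zero; suc; _!)
open import Data.Nat.Combinatorics using (_C_; nCk≡n!/k![n-k]!; k![n∸k]!∣n!; nCn≡1)
open import Data.Nat.Coprimality using (prime⇒coprime; coprime-Bézout)
open import Data.Nat.DivMod using (m/n*n≡m)
open import Data.Nat.Divisibility as ℕ∣ using (divides)
import Data.Nat.GCD as GCD
open import Data.Nat.ListAction using (product)
open import Data.Nat.ListAction.Properties using (product-++; product-↭)
open import Data.Nat.Primality using (Prime; euclidsLemma; prime⇒nonZero; prime⇒nonTrivial)
import Data.Nat.Properties as ℕ
import Data.Nat.Tactic.RingSolver as ℕ-Solver
open import Data.Product as Prod using (_×_; _,_; ∃; proj₁; proj₂)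
open import Data.Sum as Sum using (_⊎_; inj₁; inj₂)
open import Function using (_∘_)
open import Relation.Binary.Bundles using (Setoid)
open import Relation.Binary.PropositionalEquality as ≡ using (_≡_; _≢_; refl; cong; cong₂; subst)
open import Relation.Binary.Structures using (IsEquivalence)
open import Relation.Nullary using (¬_)

open import Defs
  using (_≡ᵢ_[mod_]; Elt; _≈_[mod_]; isOneMod4; mul; norm; pow; one; minusOne; InG; LegendreMinusOne)

prime>1 : ∀ {p} → Prime p → 1 ℕ.< p
prime>1 {p} p-prime = ℕ.nonTrivial⇒n>1 p {{prime⇒nonTrivial p-prime}}

odd>1⇒≡3+2m : ∀ n → 1 ℕ.< n → ¬ (2 ℕ∣.∣ n) → ∃ λ m → n ≡ 3 ℕ.+ 2 ℕ.* m
odd>1⇒≡3+2m 1 (ℕ.s≤s ()) _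
odd>1⇒≡3+2m 2 _ 2∤2 = ⊥-elim (2∤2 ℕ∣.∣-refl)
odd>1⇒≡3+2m 3 _ _   = 0 , refl
odd>1⇒≡3+2m (suc (suc (suc (suc n)))) _ 2∤4+n
  with odd>1⇒≡3+2m (2 ℕ.+ n) (ℕ.s≤s (ℕ.s≤s ℕ.z≤n)) (2∤4+n ∘ ℕ∣.∣m∣n⇒∣m+n ℕ∣.∣-refl)
... | m , 2+n≡3+2m = suc m , ≡.trans (cong (2 ℕ.+_) 2+n≡3+2m) (cong (3 ℕ.+_) (≡.sym (ℕ.*-suc 2 m)))

prime∤m! : ∀ {p m} → Prime p → m ℕ.< p → ¬ (p ℕ∣.∣ m !)
prime∤m! {m = zero}  p-prime _   p∣1  = ℕ.<⇒≱ (prime>1 p-prime) (ℕ∣.∣⇒≤ p∣1)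
prime∤m! {m = suc m} p-prime m<p p∣m! with euclidsLemma (suc m) (m !) p-prime p∣m!
... | inj₁ p∣1+m = ℕ.<⇒≱ m<p (ℕ∣.∣⇒≤ p∣1+m)
... | inj₂ p∣m!  = prime∤m! p-prime (ℕ.<-trans (ℕ.n<1+n m) m<p) p∣m!

n∣n! : ∀ n → .{{ℕ.NonZero n}} → n ℕ∣.∣ n !
n∣n! (suc n) = ℕ∣.m∣m*n (n !)

nCk*k!*[n∸k]!≡n! : ∀ {n k} → k ℕ.≤ n → (n C k) ℕ.* (k ! ℕ.* (n ℕ.∸ k) !) ≡ n !
nCk*k!*[n∸k]!≡n! {n} {k} k≤n = ≡.trans
  (cong (ℕ._* (k ! ℕ.* (n ℕ.∸ k) !)) (nCk≡n!/k![n-k]! k≤n))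
  (m/n*n≡m {{ℕ._!*_!≢0 k (n ℕ.∸ k)}} (k![n∸k]!∣n! k≤n))

-- p divides p! = (p C k) k! (p − k)! but neither factorial on the right.
prime∣pCk : ∀ {p k} → Prime p → 0 ℕ.< k → k ℕ.< p → p ℕ∣.∣ p C k
prime∣pCk {p} {k} p-prime 0<k k<p
  with euclidsLemma (p C k) (k ! ℕ.* (p ℕ.∸ k) !) p-prime
         (subst (p ℕ∣.∣_) (≡.sym (nCk*k!*[n∸k]!≡n! (ℕ.<⇒≤ k<p))) (n∣n! p {{prime⇒nonZero p-prime}}))
... | inj₁ p∣pCk = p∣pCk
... | inj₂ p∣k![p∸k]! with euclidsLemma (k !) ((p ℕ.∸ k) !) p-prime p∣k![p∸k]!
...   | inj₁ p∣k!     = ⊥-elim (prime∤m! p-prime k<p p∣k!)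
...   | inj₂ p∣[p∸k]! = ⊥-elim (prime∤m! p-prime (ℕ.∸-monoʳ-< 0<k (ℕ.<⇒≤ k<p)) p∣[p∸k]!)

product-applyUpTo-∷ʳ : ∀ f n → product (applyUpTo f (suc n)) ≡ product (applyUpTo f n) ℕ.* f n
product-applyUpTo-∷ʳ f n = begin
  product (applyUpTo f (suc n))            ≡⟨ cong product (applyUpTo-∷ʳ f n) ⟨
  product (applyUpTo f n ++ [ f n ])       ≡⟨ product-++ (applyUpTo f n) [ f n ] ⟩
  product (applyUpTo f n) ℕ.* (f n ℕ.* 1)  ≡⟨ cong (product (applyUpTo f n) ℕ.*_) (ℕ.*-identityʳ (f n)) ⟩
  product (applyUpTo f n) ℕ.* f n          ∎
  where open ≡.≡-Reasoning

product-applyUpTo-suc : ∀ n → product (applyUpTo suc n) ≡ n !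
product-applyUpTo-suc zero    = refl
product-applyUpTo-suc (suc n) = ≡.trans (product-applyUpTo-∷ʳ suc n)
  (≡.trans (cong (ℕ._* suc n) (product-applyUpTo-suc n)) (ℕ.*-comm (n !) (suc n)))

-- The remainder (q − q′) d of q d must be below d, which forces q′ = q.
[q*d]/ℕd≡q : ∀ q d .{{_ : ℕ.NonZero d}} → (q ℤ.* + d) ℤ./ℕ d ≡ q
[q*d]/ℕd≡q q d with ℤ.∣ q ℤ.- (q ℤ.* + d) ℤ./ℕ d ∣ in |q-q′|≡
... | zero  = ≡.sym (ℤ.i-j≡0⇒i≡j q _ (ℤ.∣i∣≡0⇒i≡0 |q-q′|≡))
... | suc k = ⊥-elim (ℕ.<⇒≱ (ℤ.n%ℕd<d (q ℤ.* + d) d) d≤r)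
  where
  q′ = (q ℤ.* + d) ℤ./ℕ d
  r  = (q ℤ.* + d) %ℕ d
  r+q′d≡qd : + r ℤ.+ q′ ℤ.* + d ≡ q ℤ.* + d
  r+q′d≡qd = ≡.sym (ℤ.a≡a%ℕn+[a/ℕn]*n (q ℤ.* + d) d)
  r≡[1+k]d : r ≡ suc k ℕ.* d
  r≡[1+k]d = begin
    ℤ.∣ + r ∣                                      ≡⟨ cong ℤ.∣_∣ (r≡[r+q′d]-q′d (+ r) q′ (+ d)) ⟩
    ℤ.∣ (+ r ℤ.+ q′ ℤ.* + d) ℤ.- q′ ℤ.* + d ∣      ≡⟨ cong (λ e → ℤ.∣ e ℤ.- q′ ℤ.* + d ∣) r+q′d≡qd ⟩
    ℤ.∣ q ℤ.* + d ℤ.- q′ ℤ.* + d ∣                 ≡⟨ cong ℤ.∣_∣ (qd-q′d≡[q-q′]d q q′ (+ d)) ⟩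
    ℤ.∣ (q ℤ.- q′) ℤ.* + d ∣                       ≡⟨ ℤ.abs-* (q ℤ.- q′) (+ d) ⟩
    ℤ.∣ q ℤ.- q′ ∣ ℕ.* d                           ≡⟨ cong (ℕ._* d) |q-q′|≡ ⟩
    suc k ℕ.* d                                    ∎
    where
    open ≡.≡-Reasoning
    r≡[r+q′d]-q′d : ∀ r q′ d → r ≡ (r ℤ.+ q′ ℤ.* d) ℤ.- q′ ℤ.* d
    r≡[r+q′d]-q′d = solve-∀
    qd-q′d≡[q-q′]d : ∀ q q′ d → q ℤ.* d ℤ.- q′ ℤ.* d ≡ (q ℤ.- q′) ℤ.* d
    qd-q′d≡[q-q′]d = solve-∀
  d≤r : d ℕ.≤ r
  d≤r = subst (d ℕ.≤_) (≡.sym r≡[1+k]d) (ℕ.m≤m+n d (k ℕ.* d))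

module CharacteristicPrime {a ℓ} (S : CommutativeSemiring a ℓ) where

  open CommutativeSemiring S
  open import Algebra.Properties.CommutativeSemiring.Binomial S using (theorem; binomialTerm)
  import Algebra.Properties.Monoid.Mult *-monoid as Pow
  open import Algebra.Properties.Semiring.Exp semiring using (_^_)
  import Algebra.Properties.Semiring.Mult semiring as Mult
  open import Algebra.Properties.Semiring.Sum semiring
    using (sum; sum-init-last; sum-cong-≋; sum-replicate-zero)
  open import Relation.Binary.Reasoning.Setoid setoid

  binomialTerm-last : ∀ x y n → binomialTerm x y n (fromℕ n) ≈ x ^ n
  binomialTerm-last x y n = begin
    (n C toℕ (fromℕ n)) Mult.× (x ^ toℕ (fromℕ n) * y ^ (n ℕ.∸ toℕ (fromℕ n)))
      ≡⟨ cong (λ k → (n C k) Mult.× (x ^ k * y ^ (n ℕ.∸ k))) (Fin.toℕ-fromℕ n) ⟩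
    (n C n) Mult.× (x ^ n * y ^ (n ℕ.∸ n))
      ≡⟨ cong₂ (λ c k → c Mult.× (x ^ n * y ^ k)) (nCn≡1 n) (ℕ.n∸n≡0 n) ⟩
    1 Mult.× (x ^ n * 1#)  ≈⟨ Mult.×-homo-1 _ ⟩
    x ^ n * 1#             ≈⟨ *-identityʳ _ ⟩
    x ^ n                  ∎

  binomial-outer-terms : ∀ x y n →
    (∀ k → 0 ℕ.< k → k ℕ.< suc n → ∀ z → (suc n C k) Mult.× z ≈ 0#) →
    (x + y) ^ suc n ≈ x ^ suc n + y ^ suc n
  binomial-outer-terms x y n inner≈0 = begin
    (x + y) ^ suc n                                   ≈⟨ theorem (suc n) x y ⟩
    t Fin.zero + sum (t ∘ Fin.suc)                    ≈⟨ +-cong (+-identityʳ _) (sum-init-last (t ∘ Fin.suc)) ⟩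
    1# * y ^ suc n + (sum inner + t (fromℕ (suc n)))  ≈⟨ +-cong (*-identityˡ _) (+-congʳ inner-sum≈0) ⟩
    y ^ suc n + (0# + t (fromℕ (suc n)))              ≈⟨ +-congˡ (+-identityˡ _) ⟩
    y ^ suc n + t (fromℕ (suc n))                     ≈⟨ +-congˡ (binomialTerm-last x y (suc n)) ⟩
    y ^ suc n + x ^ suc n                             ≈⟨ +-comm _ _ ⟩
    x ^ suc n + y ^ suc n                             ∎
    where
    t = binomialTerm x y (suc n)
    inner : Fin n → Carrier
    inner i = t (Fin.suc (inject₁ i))
    inner-sum≈0 : sum inner ≈ 0#
    inner-sum≈0 = trans (sum-cong-≋ (λ i → inner≈0 _ ℕ.z<s (ℕ.s≤s (inject₁<n i)) _)) (sum-replicate-zero n)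
      where
      inject₁<n : ∀ i → toℕ (inject₁ i) ℕ.< n
      inject₁<n i = subst (ℕ._< n) (≡.sym (Fin.toℕ-inject₁ i)) (Fin.toℕ<n i)

  module _ {p} (p-prime : Prime p) (char-p : ∀ x → p Mult.× x ≈ 0#) where

    private
      instance
        p≢0 : ℕ.NonZero p
        p≢0 = prime⇒nonZero p-prime

    p∣n⇒n×x≈0 : ∀ {n} → p ℕ∣.∣ n → ∀ x → n Mult.× x ≈ 0#
    p∣n⇒n×x≈0 (divides q refl) x = begin
      (q ℕ.* p) Mult.× x     ≡⟨ cong (Mult._× x) (ℕ.*-comm q p) ⟩
      (p ℕ.* q) Mult.× x     ≈⟨ Mult.×-assocˡ x p q ⟨
      p Mult.× (q Mult.× x)  ≈⟨ char-p (q Mult.× x) ⟩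
      0#                     ∎

    ^p-homo-+ : ∀ x y → (x + y) ^ p ≈ x ^ p + y ^ p
    ^p-homo-+ x y = subst (λ n → (x + y) ^ n ≈ x ^ n + y ^ n) (ℕ.suc-pred p)
      (binomial-outer-terms x y (ℕ.pred p) λ k 0<k k<p →
        p∣n⇒n×x≈0 (subst (λ n → p ℕ∣.∣ n C k) (≡.sym (ℕ.suc-pred p))
          (prime∣pCk p-prime 0<k (subst (k ℕ.<_) (ℕ.suc-pred p) k<p))))

    [n×1#]^p≈n×1# : ∀ n → (n Mult.× 1#) ^ p ≈ n Mult.× 1#
    [n×1#]^p≈n×1# zero    = subst (λ k → 0# ^ k ≈ 0#) (ℕ.suc-pred p) (zeroˡ _)
    [n×1#]^p≈n×1# (suc n) = begin
      (1# + n Mult.× 1#) ^ p      ≈⟨ ^p-homo-+ 1# (n Mult.× 1#) ⟩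
      1# ^ p + (n Mult.× 1#) ^ p  ≈⟨ +-cong (Pow.×-idem (*-identityˡ 1#) p) ([n×1#]^p≈n×1# n) ⟩
      1# + n Mult.× 1#            ∎

module _ {a ℓ} (S : Semiring a ℓ) where

  open Semiring S
  open import Algebra.Properties.Semiring.Exp S using (_^_; ^-homo-*; ^-congʳ)
  open import Relation.Binary.Reasoning.Setoid setoid

  private
    2k*u≡k*u+k*u : ∀ k u → 2 ℕ.* k ℕ.* u ≡ k ℕ.* u ℕ.+ k ℕ.* u
    2k*u≡k*u+k*u = ℕ-Solver.solve-∀

  ^-2-power-descent : ∀ (m : Carrier) → (∀ y → y * y ≈ 1# → y ≈ 1# ⊎ y ≈ m) →
    ∀ {x u} s → x ^ (2 ℕ.^ s ℕ.* u) ≈ 1# →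
    x ^ u ≈ 1# ⊎ ∃ λ r → r ℕ.< s × x ^ (2 ℕ.^ r ℕ.* u) ≈ m
  ^-2-power-descent m sqrt-1 {x} {u} zero x^u≈1 =
    inj₁ (trans (^-congʳ x (≡.sym (ℕ.*-identityˡ u))) x^u≈1)
  ^-2-power-descent m sqrt-1 {x} {u} (suc s) x^[2^[1+s]u]≈1
    with sqrt-1 (x ^ (2 ℕ.^ s ℕ.* u)) (begin
      y * y                                  ≈⟨ ^-homo-* x (2 ℕ.^ s ℕ.* u) (2 ℕ.^ s ℕ.* u) ⟨
      x ^ (2 ℕ.^ s ℕ.* u ℕ.+ 2 ℕ.^ s ℕ.* u)  ≡⟨ cong (x ^_) (2k*u≡k*u+k*u (2 ℕ.^ s) u) ⟨
      x ^ (2 ℕ.^ suc s ℕ.* u)                ≈⟨ x^[2^[1+s]u]≈1 ⟩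
      1#                                     ∎)
    where y = x ^ (2 ℕ.^ s ℕ.* u)
  ... | inj₂ y≈m = inj₂ (s , ℕ.n<1+n s , y≈m)
  ... | inj₁ y≈1 = Sum.map₂ (Prod.map₂ (Prod.map₁ ℕ.m<n⇒m<1+n)) (^-2-power-descent m sqrt-1 s y≈1)

module Congruence (n : ℕ) where

  open import Data.Integer using (_+_; _-_; _*_; -_)

  -- A record rather than a synonym, so that x and y can be inferred from a proof of x ∼ y.
  infix 4 _∼_ _≁_
  record _∼_ (x y : ℤ) : Set where
    constructor mk∼
    field n∣x-y : + n ℤ∣.∣ (x - y)

  _≁_ : ℤ → ℤ → Set
  x ≁ y = ¬ (x ∼ y)

  Nonresidue : ℤ → Set
  Nonresidue a = ∀ t → t * t ≁ a

  ∼-by : ∀ {x y} k → x - y ≡ k * + n → x ∼ y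
  ∼-by k eq = mk∼ (ℤ∣.divides k eq)

  ∼⇒≡ᵢ : ∀ {x y} → x ∼ y → x ≡ᵢ y [mod n ]
  ∼⇒≡ᵢ (mk∼ d) = ℤ∣.∣⇒∣ᵤ d

  ≡ᵢ⇒∼ : ∀ {x y} → x ≡ᵢ y [mod n ] → x ∼ y
  ≡ᵢ⇒∼ d = mk∼ (ℤ∣.∣ᵤ⇒∣ d)

  private
    along : ∀ {d e} → d ≡ e → + n ℤ∣.∣ d → + n ℤ∣.∣ e
    along = subst (+ n ℤ∣.∣_)

    -[x-y]≡y-x : ∀ x y → - (x - y) ≡ y - x
    -[x-y]≡y-x = solve-∀
    [x-y]+[y-z]≡x-z : ∀ x y z → (x - y) + (y - z) ≡ x - z
    [x-y]+[y-z]≡x-z = solve-∀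
    [x-y]+[u-v]≡[x+u]-[y+v] : ∀ x y u v → (x - y) + (u - v) ≡ (x + u) - (y + v)
    [x-y]+[u-v]≡[x+u]-[y+v] = solve-∀
    [x-y]u+y[u-v]≡xu-yv : ∀ x y u v → (x - y) * u + y * (u - v) ≡ x * u - y * v
    [x-y]u+y[u-v]≡xu-yv = solve-∀
    -[x-y]≡-x-[-y] : ∀ x y → - (x - y) ≡ (- x) - (- y)
    -[x-y]≡-x-[-y] = solve-∀

  ≡⇒∼ : ∀ {x y} → x ≡ y → x ∼ y
  ≡⇒∼ {x} refl = ∼-by (+ 0) (ℤ.+-inverseʳ x)

  ∼-refl : ∀ {x} → x ∼ x
  ∼-refl = ≡⇒∼ refl

  ∼-sym : ∀ {x y} → x ∼ y → y ∼ x
  ∼-sym {x} {y} (mk∼ d) = mk∼ (along (-[x-y]≡y-x x y) (ℤ∣.∣m⇒∣-m d))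

  ∼-trans : ∀ {x y z} → x ∼ y → y ∼ z → x ∼ z
  ∼-trans {x} {y} {z} (mk∼ d) (mk∼ e) = mk∼ (along ([x-y]+[y-z]≡x-z x y z) (ℤ∣.∣m∣n⇒∣m+n d e))

  ∼-isEquivalence : IsEquivalence _∼_
  ∼-isEquivalence = record { refl = ∼-refl ; sym = ∼-sym ; trans = ∼-trans }

  ∼-setoid : Setoid _ _
  ∼-setoid = record { isEquivalence = ∼-isEquivalence }

  +-cong : ∀ {x y u v} → x ∼ y → u ∼ v → x + u ∼ y + v
  +-cong {x} {y} {u} {v} (mk∼ d) (mk∼ e) =
    mk∼ (along ([x-y]+[u-v]≡[x+u]-[y+v] x y u v) (ℤ∣.∣m∣n⇒∣m+n d e))

  *-cong : ∀ {x y u v} → x ∼ y → u ∼ v → x * u ∼ y * v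
  *-cong {x} {y} {u} {v} (mk∼ d) (mk∼ e) =
    mk∼ (along ([x-y]u+y[u-v]≡xu-yv x y u v) (ℤ∣.∣m∣n⇒∣m+n (ℤ∣.∣m⇒∣m*n u d) (ℤ∣.∣n⇒∣m*n y e)))

  -‿cong : ∀ {x y} → x ∼ y → - x ∼ - y
  -‿cong {x} {y} (mk∼ d) = mk∼ (along (-[x-y]≡-x-[-y] x y) (ℤ∣.∣m⇒∣-m d))

  n∼0 : + n ∼ + 0
  n∼0 = ∼-by (+ 1) (≡.trans (ℤ.+-identityʳ (+ n)) (≡.sym (ℤ.*-identityˡ (+ n))))

module PrimeModulus (p : ℕ) (p-prime : Prime p) where

  open import Data.Integer using (_+_; _-_; _*_; -_)
  open Congruence p public
  open import Relation.Binary.Reasoning.Setoid ∼-setoid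

  instance
    p≢0 : ℕ.NonZero p
    p≢0 = prime⇒nonZero p-prime

  private
    x-0≡x : ∀ x → x - + 0 ≡ x
    x-0≡x = ℤ.+-identityʳ

  x-y∼0⇒x∼y : ∀ {x y} → x - y ∼ + 0 → x ∼ y
  x-y∼0⇒x∼y {x} {y} (mk∼ d) = mk∼ (subst (+ p ℤ∣.∣_) (x-0≡x (x - y)) d)

  x*y∼0⇒x∼0⊎y∼0 : ∀ {x y} → x * y ∼ + 0 → x ∼ + 0 ⊎ y ∼ + 0
  x*y∼0⇒x∼0⊎y∼0 {x} {y} xy∼0 = Sum.map p∣∣z∣⇒z∼0 p∣∣z∣⇒z∼0
    (euclidsLemma ℤ.∣ x ∣ ℤ.∣ y ∣ p-prime (subst (p ℕ∣.∣_) (ℤ.abs-* x y) (z∼0⇒p∣∣z∣ xy∼0)))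
    where
    z∼0⇒p∣∣z∣ : ∀ {z} → z ∼ + 0 → p ℕ∣.∣ ℤ.∣ z ∣
    z∼0⇒p∣∣z∣ {z} z∼0 = subst (λ w → p ℕ∣.∣ ℤ.∣ w ∣) (x-0≡x z) (∼⇒≡ᵢ z∼0)
    p∣∣z∣⇒z∼0 : ∀ {z} → p ℕ∣.∣ ℤ.∣ z ∣ → z ∼ + 0
    p∣∣z∣⇒z∼0 {z} d = ≡ᵢ⇒∼ (subst (λ w → p ℕ∣.∣ ℤ.∣ w ∣) (≡.sym (x-0≡x z)) d)

  *-cancelʳ-∼ : ∀ {x y z} → z ≁ + 0 → x * z ∼ y * z → x ∼ y
  *-cancelʳ-∼ {x} {y} {z} z≁0 xz∼yz with x*y∼0⇒x∼0⊎y∼0 (begin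
    (x - y) * z    ≡⟨ [x-y]z≡xz-yz x y z ⟩
    x * z - y * z  ≈⟨ +-cong xz∼yz ∼-refl ⟩
    y * z - y * z  ≡⟨ ℤ.+-inverseʳ (y * z) ⟩
    + 0            ∎)
    where
    [x-y]z≡xz-yz : ∀ x y z → (x - y) * z ≡ x * z - y * z
    [x-y]z≡xz-yz = solve-∀
  ... | inj₁ x-y∼0 = x-y∼0⇒x∼y x-y∼0
  ... | inj₂ z∼0   = ⊥-elim (z≁0 z∼0)

  *-cancelˡ-∼ : ∀ {x y z} → z ≁ + 0 → z * x ∼ z * y → x ∼ y
  *-cancelˡ-∼ {x} {y} {z} z≁0 zx∼zy =
    *-cancelʳ-∼ z≁0 (∼-trans (≡⇒∼ (ℤ.*-comm x z)) (∼-trans zx∼zy (≡⇒∼ (ℤ.*-comm z y))))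

  x*x∼1⇒x∼±1 : ∀ {x} → x * x ∼ + 1 → x ∼ + 1 ⊎ x ∼ - + 1
  x*x∼1⇒x∼±1 {x} x²∼1 = Sum.map x-y∼0⇒x∼y x-y∼0⇒x∼y (x*y∼0⇒x∼0⊎y∼0 (begin
    (x - + 1) * (x - - + 1)  ≡⟨ [x-1][x+1]≡x²-1 x ⟩
    x * x - + 1              ≈⟨ +-cong x²∼1 ∼-refl ⟩
    + 0                      ∎))
    where
    [x-1][x+1]≡x²-1 : ∀ x → (x - + 1) * (x - - + 1) ≡ x * x - + 1
    [x-1][x+1]≡x²-1 = solve-∀

  private
    p∣d<p⇒d≡0 : ∀ {d} → p ℕ∣.∣ d → d ℕ.< p → d ≡ 0
    p∣d<p⇒d≡0 {zero}  _   _   = refl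
    p∣d<p⇒d≡0 {suc d} p∣d d<p = ⊥-elim (ℕ∣.>⇒∤ d<p p∣d)

    ≤-residue-injective : ∀ {m n} → m ℕ.≤ n → n ℕ.< p → + n ∼ + m → m ≡ n
    ≤-residue-injective {m} {n} m≤n n<p n∼m =
      ℕ.≤-antisym m≤n (ℕ.m∸n≡0⇒m≤n (p∣d<p⇒d≡0 p∣n∸m (ℕ.≤-<-trans (ℕ.m∸n≤m n m) n<p)))
      where
      p∣n∸m : p ℕ∣.∣ n ℕ.∸ m
      p∣n∸m = subst (p ℕ∣.∣_) (cong ℤ.∣_∣ (≡.trans (ℤ.m-n≡m⊖n n m) (ℤ.⊖-≥ m≤n))) (∼⇒≡ᵢ n∼m)

  residue-injective : ∀ {m n} → m ℕ.< p → n ℕ.< p → + m ∼ + n → m ≡ n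
  residue-injective {m} {n} m<p n<p m∼n with ℕ.≤-total m n
  ... | inj₁ m≤n = ≤-residue-injective m≤n n<p (∼-sym m∼n)
  ... | inj₂ n≤m = ≡.sym (≤-residue-injective n≤m m<p m∼n)

  NonzeroResidue : ℕ → Set
  NonzeroResidue m = 0 ℕ.< m × m ℕ.< p

  nonzeroResidue≁0 : ∀ {m} → NonzeroResidue m → + m ≁ + 0
  nonzeroResidue≁0 (0<m , m<p) m∼0 = ℕ.<⇒≢ 0<m (≡.sym (residue-injective m<p (ℕ.<-trans 0<m m<p) m∼0))

  x∼x%ℕp : ∀ x → x ∼ + (x %ℕ p)
  x∼x%ℕp x = ∼-by (x ℤ./ℕ p)
    (≡.trans (cong (_- + (x %ℕ p)) (ℤ.a≡a%ℕn+[a/ℕn]*n x p)) ([r+qp]-r≡qp (+ (x %ℕ p)) (x ℤ./ℕ p) (+ p)))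
    where
    [r+qp]-r≡qp : ∀ r q p → (r + q * p) - r ≡ q * p
    [r+qp]-r≡qp = solve-∀

  private
    lift-Bézout : ∀ i j k l → 1 ℕ.+ i ℕ.* j ≡ k ℕ.* l → + 1 + + i * + j ≡ + k * + l
    lift-Bézout i j k l eq =
      ≡.trans (cong (_+_ (+ 1)) (≡.sym (ℤ.pos-* i j))) (≡.trans (cong +_ eq) (ℤ.pos-* k l))

  ∃-inverse : ∀ {m} → NonzeroResidue m → ∃ λ t → + m * t ∼ + 1
  ∃-inverse {m} (0<m , m<p) with coprime-Bézout (prime⇒coprime p-prime {{ℕ.>-nonZero 0<m}} m<p)
  ... | GCD.Bézout.+- a b 1+bm≡ap = - + b , ∼-by (- + a) (≡.trans
          (m[-b]-1≡-[1+bm] (+ m) (+ b))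
          (≡.trans (cong -_ (lift-Bézout b m a p 1+bm≡ap)) (ℤ.neg-distribˡ-* (+ a) (+ p))))
    where
    m[-b]-1≡-[1+bm] : ∀ m b → m * - b - + 1 ≡ - (+ 1 + b * m)
    m[-b]-1≡-[1+bm] = solve-∀
  ... | GCD.Bézout.-+ a b 1+ap≡bm = + b , ∼-by (+ a) (≡.trans
          (cong (_- + 1) (ℤ.*-comm (+ m) (+ b)))
          (≡.trans (cong (_- + 1) (≡.sym (lift-Bézout a p b m 1+ap≡bm))) ([1+ap]-1≡ap (+ a) (+ p))))
    where
    [1+ap]-1≡ap : ∀ a p → (+ 1 + a * p) - + 1 ≡ a * p
    [1+ap]-1≡ap = solve-∀

  ∃-quotient : ∀ {m c} → NonzeroResidue m → c ≁ + 0 → ∃ λ k → NonzeroResidue k × + m * + k ∼ c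
  ∃-quotient {m} {c} m-res c≁0 with ∃-inverse m-res
  ... | t , mt∼1 = k , (0<k , ℤ.n%ℕd<d (t * c) p) , mk∼c
    where
    k = (t * c) %ℕ p
    mk∼c : + m * + k ∼ c
    mk∼c = begin
      + m * + k      ≈⟨ *-cong (∼-refl {+ m}) (∼-sym (x∼x%ℕp (t * c))) ⟩
      + m * (t * c)  ≡⟨ ℤ.*-assoc (+ m) t c ⟨
      + m * t * c    ≈⟨ *-cong mt∼1 ∼-refl ⟩
      + 1 * c        ≡⟨ ℤ.*-identityˡ c ⟩
      c              ∎
    0<k : 0 ℕ.< k
    0<k = ℕ.n≢0⇒n>0 λ k≡0 → c≁0 (∼-trans (∼-sym mk∼c)
            (≡⇒∼ (≡.trans (cong (λ j → + m * + j) k≡0) (ℤ.*-zeroʳ (+ m)))))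

module PairedProducts (p : ℕ) (p-prime : Prime p) where

  open import Data.Integer using (_+_; _*_; _^_)
  open PrimeModulus p p-prime
  open import Relation.Binary.Reasoning.Setoid ∼-setoid

  record Paired (c : ℤ) (xs : List ℕ) : Set where
    field
      unique   : Unique xs
      residues : All NonzeroResidue xs
      partner  : ∀ {x} → x ∈ xs → ∃ λ y → y ∈ xs × y ≢ x × + x * + y ∼ c

  Paired-resp-↭ : ∀ {c xs ys} → xs ↭ ys → Paired c xs → Paired c ys
  Paired-resp-↭ σ P = record
    { unique   = ↭ₛ.Unique-resp-↭ (≡.setoid ℕ) (↭⇒↭ₛ σ) unique
    ; residues = All-resp-↭ σ residues
    ; partner  = Prod.map₂ (Prod.map₁ (∈-resp-↭ σ)) ∘ partner ∘ ∈-resp-↭ (↭-sym σ)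
    }
    where open Paired P

  private
    partner-unique : ∀ {c x y z} → NonzeroResidue x → y ℕ.< p → z ℕ.< p →
                     + y * + x ∼ c → + z * + x ∼ c → y ≡ z
    partner-unique x-res y<p z<p yx∼c zx∼c =
      residue-injective y<p z<p (*-cancelʳ-∼ (nonzeroResidue≁0 x-res) (∼-trans yx∼c (∼-sym zx∼c)))

  drop-pair : ∀ {c x y ys} → + x * + y ∼ c → Paired c (x ∷ y ∷ ys) → Paired c ys
  drop-pair {c} {x} {y} {ys} xy∼c P = record
    { unique   = AllPairs.tail (AllPairs.tail unique)
    ; residues = All.tail (All.tail residues)
    ; partner  = partner′
    }
    where
    open Paired P
    x-res = All.lookup residues (here refl)
    y-res = All.lookup residues (there (here refl))
    <p : ∀ {z} → z ∈ ys → z ℕ.< p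
    <p = proj₂ ∘ All.lookup residues ∘ there ∘ there
    x∉ys : ∀ {z} → z ∈ ys → x ≢ z
    x∉ys = All.lookup (AllPairs.head unique) ∘ there
    y∉ys : ∀ {z} → z ∈ ys → y ≢ z
    y∉ys = All.lookup (AllPairs.head (AllPairs.tail unique))
    partner′ : ∀ {z} → z ∈ ys → ∃ λ z′ → z′ ∈ ys × z′ ≢ z × + z * + z′ ∼ c
    partner′ {z} z∈ys with partner (there (there z∈ys))
    ... | _ , here refl , _ , zx∼c =
      ⊥-elim (y∉ys z∈ys (partner-unique x-res (proj₂ y-res) (<p z∈ys) yx∼c zx∼c))
      where yx∼c = ∼-trans (≡⇒∼ (ℤ.*-comm (+ y) (+ x))) xy∼c
    ... | _ , there (here refl) , _ , zy∼c =
      ⊥-elim (x∉ys z∈ys (partner-unique y-res (proj₂ x-res) (<p z∈ys) xy∼c zy∼c))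
    ... | z′ , there (there z′∈ys) , z′≢z , zz′∼c = z′ , z′∈ys , z′≢z , zz′∼c

  pair-off : ∀ {c x xs} → Paired c (x ∷ xs) →
             ∃ λ y → ∃ λ ys → (x ∷ xs ↭ x ∷ y ∷ ys) × + x * + y ∼ c
  pair-off P with Paired.partner P (here refl)
  ... | _ , here refl , y≢x , _ = ⊥-elim (y≢x refl)
  ... | y , there y∈xs , _ , xy∼c with ∈-∃++ y∈xs
  ...   | as , bs , refl = y , as ++ bs , prep _ (shift y as bs) , xy∼c

  private
    product-paired-≤ : ∀ {c} n {xs} → length xs ℕ.≤ n → Paired c xs →
                       ∃ λ j → 2 ℕ.* j ≡ length xs × + product xs ∼ c ^ j
    product-paired-≤ _ {[]} _ _ = 0 , refl , ∼-refl
    product-paired-≤ {c} (suc n) {x ∷ xs} (ℕ.s≤s |xs|≤n) P with pair-off P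
    ... | y , ys , σ , xy∼c with product-paired-≤ n {ys} |ys|≤n (drop-pair xy∼c (Paired-resp-↭ σ P))
      where
      |ys|<|xs| : length ys ℕ.< length xs
      |ys|<|xs| = subst (length ys ℕ.<_) (≡.sym (ℕ.suc-injective (↭-length σ))) (ℕ.n<1+n _)
      |ys|≤n : length ys ℕ.≤ n
      |ys|≤n = ℕ.<⇒≤ (ℕ.<-≤-trans |ys|<|xs| |xs|≤n)
    ... | j , 2j≡|ys| , Πys∼cʲ = suc j , 2[1+j]≡|x∷xs| , Πx∷xs∼c¹⁺ʲ
      where
      2[1+j]≡|x∷xs| : 2 ℕ.* suc j ≡ length (x ∷ xs)
      2[1+j]≡|x∷xs| = ≡.trans (ℕ.*-suc 2 j) (≡.trans (cong (2 ℕ.+_) 2j≡|ys|) (≡.sym (↭-length σ)))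
      Πx∷xs∼c¹⁺ʲ : + product (x ∷ xs) ∼ c ^ suc j
      Πx∷xs∼c¹⁺ʲ = begin
        + product (x ∷ xs)          ≡⟨ cong +_ (product-↭ σ) ⟩
        + product (x ∷ y ∷ ys)      ≡⟨ ℤ.pos-* x _ ⟩
        + x * + product (y ∷ ys)    ≡⟨ cong (_*_ (+ x)) (ℤ.pos-* y _) ⟩
        + x * (+ y * + product ys)  ≡⟨ ℤ.*-assoc (+ x) (+ y) _ ⟨
        + x * + y * + product ys    ≈⟨ *-cong xy∼c Πys∼cʲ ⟩
        c * c ^ j                   ∎

  product-paired : ∀ {c xs} → Paired c xs → ∃ λ j → 2 ℕ.* j ≡ length xs × + product xs ∼ c ^ j
  product-paired {xs = xs} = product-paired-≤ (length xs) ℕ.≤-refl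

module OddPrime (p : ℕ) (p-prime : Prime p) (m : ℕ) (p≡3+2m : p ≡ 3 ℕ.+ 2 ℕ.* m) where

  open import Data.Integer using (_+_; _-_; _*_; -_; _^_)
  open PrimeModulus p p-prime public
  open PairedProducts p p-prime
  open import Relation.Binary.Reasoning.Setoid ∼-setoid

  p-1<p : 2 ℕ.+ 2 ℕ.* m ℕ.< p
  p-1<p = subst (2 ℕ.+ 2 ℕ.* m ℕ.<_) (≡.sym p≡3+2m) (ℕ.n<1+n _)

  p-1∼-1 : + (2 ℕ.+ 2 ℕ.* m) ∼ - + 1
  p-1∼-1 = ∼-by (+ 1) (≡.trans (cong +_ (≡.trans (ℕ.+-comm (2 ℕ.+ 2 ℕ.* m) 1) (≡.sym p≡3+2m)))
                               (≡.sym (ℤ.*-identityˡ (+ p))))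

  2≁0 : + 2 ≁ + 0
  2≁0 = nonzeroResidue≁0 (ℕ.z<s , subst (2 ℕ.<_) (≡.sym p≡3+2m) (ℕ.m≤m+n 3 (2 ℕ.* m)))

  2*[2+m]∼1 : + 2 * + (2 ℕ.+ m) ∼ + 1
  2*[2+m]∼1 = begin
    + 2 * + (2 ℕ.+ m)        ≡⟨ ℤ.pos-* 2 (2 ℕ.+ m) ⟨
    + (2 ℕ.* (2 ℕ.+ m))      ≡⟨ cong +_ (2[2+m]≡3+2m+1 m) ⟩
    + (3 ℕ.+ 2 ℕ.* m) + + 1  ≡⟨ cong (λ q → + q + + 1) p≡3+2m ⟨
    + p + + 1                ≈⟨ +-cong n∼0 (∼-refl {+ 1}) ⟩
    + 1                      ∎
    where
    2[2+m]≡3+2m+1 : ∀ m → 2 ℕ.* (2 ℕ.+ m) ≡ (3 ℕ.+ 2 ℕ.* m) ℕ.+ 1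
    2[2+m]≡3+2m+1 = ℕ-Solver.solve-∀

  4*-nonresidue : ∀ {a} → Nonresidue a → Nonresidue (+ 4 * a)
  4*-nonresidue {a} a-nonres t t²∼4a = a-nonres (h * t) (begin
    h * t * (h * t)            ≡⟨ rearrange h t ⟩
    h * h * (t * t)            ≈⟨ *-cong (∼-refl {h * h}) t²∼4a ⟩
    h * h * (+ 4 * a)          ≡⟨ regroup h a ⟩
    (+ 2 * h) * (+ 2 * h) * a  ≈⟨ *-cong (*-cong 2*[2+m]∼1 2*[2+m]∼1) (∼-refl {a}) ⟩
    + 1 * a                    ≡⟨ ℤ.*-identityˡ a ⟩
    a                          ∎)
    where
    h = + (2 ℕ.+ m)
    rearrange : ∀ h t → h * t * (h * t) ≡ h * h * (t * t)
    rearrange = solve-∀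
    regroup : ∀ h a → h * h * (+ 4 * a) ≡ (+ 2 * h) * (+ 2 * h) * a
    regroup = solve-∀

  nonresidue≁0 : ∀ {a} → Nonresidue a → a ≁ + 0
  nonresidue≁0 a-nonres a∼0 = a-nonres (+ 0) (∼-sym a∼0)

  units : List ℕ
  units = applyUpTo suc (2 ℕ.+ 2 ℕ.* m)

  private
    middle : List ℕ
    middle = applyUpTo (2 ℕ.+_) (2 ℕ.* m)

    ∈-middle⁺ : ∀ {x} → 2 ℕ.≤ x → x ℕ.< 2 ℕ.+ 2 ℕ.* m → x ∈ middle
    ∈-middle⁺ 2≤x x<p-1 =
      subst (_∈ middle) (ℕ.m+[n∸m]≡n 2≤x) (∈-applyUpTo⁺ (2 ℕ.+_) (ℕ.∸-monoˡ-< x<p-1 2≤x))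

    ∈-middle⁻ : ∀ {x} → x ∈ middle → 2 ℕ.≤ x × x ℕ.< 2 ℕ.+ 2 ℕ.* m
    ∈-middle⁻ x∈middle with ∈-applyUpTo⁻ (2 ℕ.+_) x∈middle
    ... | i , i<2m , refl = ℕ.m≤m+n 2 i , ℕ.+-monoʳ-< 2 i<2m

    middle≁±1 : ∀ {x} → x ∈ middle → + x ≁ + 1 × + x ≁ - + 1
    middle≁±1 x∈middle with ∈-middle⁻ x∈middle
    ... | 2≤x , x<p-1 =
      (λ x∼1 → ℕ.<⇒≢ 2≤x (≡.sym (residue-injective x<p (prime>1 p-prime) x∼1))) ,
      (λ x∼-1 → ℕ.<⇒≢ x<p-1 (residue-injective x<p p-1<p (∼-trans x∼-1 (∼-sym p-1∼-1))))
      where x<p = ℕ.<-trans x<p-1 p-1<p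

    middle-partner : ∀ {x y} → x ∈ middle → NonzeroResidue y → + x * + y ∼ + 1 → y ∈ middle × y ≢ x
    middle-partner {x} {y} x∈middle (0<y , y<p) xy∼1 = ∈-middle⁺ 2≤y y<p-1 , y≢x
      where
      x≁1  = proj₁ (middle≁±1 x∈middle)
      x≁-1 = proj₂ (middle≁±1 x∈middle)
      y≢x : y ≢ x
      y≢x refl = Sum.[ x≁1 , x≁-1 ]′ (x*x∼1⇒x∼±1 xy∼1)
      2≤y : 2 ℕ.≤ y
      2≤y = ℕ.≤∧≢⇒< 0<y λ { refl → x≁1 (∼-trans (≡⇒∼ (≡.sym (ℤ.*-identityʳ (+ x)))) xy∼1) }
      y<p-1 : y ℕ.< 2 ℕ.+ 2 ℕ.* m
      y<p-1 = ℕ.≤∧≢⇒< (ℕ.≤-pred (subst (y ℕ.<_) p≡3+2m y<p)) λ { refl → x≁-1 (begin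
        + x              ≡⟨ ℤ.neg-involutive (+ x) ⟨
        - - + x          ≡⟨ cong -_ (≡.trans (ℤ.*-comm (+ x) (- + 1)) (ℤ.-1*i≡-i (+ x))) ⟨
        - (+ x * - + 1)  ≈⟨ -‿cong (*-cong (∼-refl {+ x}) (∼-sym p-1∼-1)) ⟩
        - (+ x * + y)    ≈⟨ -‿cong xy∼1 ⟩
        - + 1            ∎) }

    middle-paired : Paired (+ 1) middle
    middle-paired = record
      { unique   = applyUpTo⁺₁ (2 ℕ.+_) (2 ℕ.* m) (λ i<j _ → ℕ.<⇒≢ (ℕ.+-monoʳ-< 2 i<j))
      ; residues = All.tabulate residue
      ; partner  = partner
      }
      where
      residue : ∀ {x} → x ∈ middle → NonzeroResidue x
      residue x∈middle with ∈-middle⁻ x∈middle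
      ... | 2≤x , x<p-1 = ℕ.<-trans ℕ.z<s 2≤x , ℕ.<-trans x<p-1 p-1<p
      partner : ∀ {x} → x ∈ middle → ∃ λ y → y ∈ middle × y ≢ x × + x * + y ∼ + 1
      partner x∈middle =
        let y , y-res , xy∼1 = ∃-quotient (residue x∈middle) (nonzeroResidue≁0 (ℕ.z<s , prime>1 p-prime))
            y∈middle , y≢x   = middle-partner x∈middle y-res xy∼1
        in y , y∈middle , y≢x , xy∼1

  -- 2, …, p − 2 pair off with their inverses, leaving 1 · (p − 1).
  wilson : + ((2 ℕ.+ 2 ℕ.* m) !) ∼ - + 1
  wilson = begin
    + ((2 ℕ.+ 2 ℕ.* m) !)                   ≡⟨ cong +_ (product-applyUpTo-suc (2 ℕ.+ 2 ℕ.* m)) ⟨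
    + product units                         ≡⟨ cong +_ Πunits≡Πmiddle*[p-1] ⟩
    + (product middle ℕ.* (2 ℕ.+ 2 ℕ.* m))  ≡⟨ ℤ.pos-* (product middle) (2 ℕ.+ 2 ℕ.* m) ⟩
    + product middle * + (2 ℕ.+ 2 ℕ.* m)    ≈⟨ *-cong Πmiddle∼1 p-1∼-1 ⟩
    + 1 * - + 1                             ∎
    where
    Πmiddle∼1 : + product middle ∼ + 1
    Πmiddle∼1 = let j , _ , Πmiddle∼1ʲ = product-paired middle-paired
                in ∼-trans Πmiddle∼1ʲ (≡⇒∼ (ℤ.^-zeroˡ j))
    Πunits≡Πmiddle*[p-1] : product units ≡ product middle ℕ.* (2 ℕ.+ 2 ℕ.* m)
    Πunits≡Πmiddle*[p-1] = ≡.trans (ℕ.*-identityˡ _) (product-applyUpTo-∷ʳ (2 ℕ.+_) (2 ℕ.* m))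

  private
    ∈-units⁺ : ∀ {y} → NonzeroResidue y → y ∈ units
    ∈-units⁺ {suc i} (_ , y<p) = ∈-applyUpTo⁺ suc (ℕ.s<s⁻¹ (subst (suc i ℕ.<_) p≡3+2m y<p))

    ∈-units⁻ : ∀ {y} → y ∈ units → NonzeroResidue y
    ∈-units⁻ y∈units with ∈-applyUpTo⁻ suc y∈units
    ... | i , i<p-1 , refl = ℕ.z<s , subst (suc i ℕ.<_) (≡.sym p≡3+2m) (ℕ.s<s i<p-1)

    units-paired : ∀ {a} → Nonresidue a → Paired a units
    units-paired {a} a-nonres = record
      { unique   = applyUpTo⁺₁ suc (2 ℕ.+ 2 ℕ.* m) (λ i<j _ → ℕ.<⇒≢ (ℕ.s<s i<j))
      ; residues = All.tabulate ∈-units⁻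
      ; partner  = partner
      }
      where
      partner : ∀ {x} → x ∈ units → ∃ λ y → y ∈ units × y ≢ x × + x * + y ∼ a
      partner {x} x∈units =
        let y , y-res , xy∼a = ∃-quotient (∈-units⁻ x∈units) (nonresidue≁0 a-nonres)
        in y , ∈-units⁺ y-res , (λ y≡x → a-nonres (+ x) (subst (λ z → + x * + z ∼ a) y≡x xy∼a)) , xy∼a

  -- (p − 1)! is the product of the (p − 1)/2 pairs {x , a/x}, each contributing a.
  euler-criterion : ∀ {a} → Nonresidue a → a ^ suc m ∼ - + 1
  euler-criterion {a} a-nonres = begin
    a ^ suc m              ≡⟨ cong (a ^_) j≡1+m ⟨
    a ^ j                  ≈⟨ ∼-sym Πunits∼aʲ ⟩
    + product units        ≡⟨ cong +_ (product-applyUpTo-suc (2 ℕ.+ 2 ℕ.* m)) ⟩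
    + ((2 ℕ.+ 2 ℕ.* m) !)  ≈⟨ wilson ⟩
    - + 1                  ∎
    where
    pairs = product-paired (units-paired a-nonres)
    j = proj₁ pairs
    Πunits∼aʲ = proj₂ (proj₂ pairs)
    j≡1+m : j ≡ suc m
    j≡1+m = ℕ.*-cancelˡ-≡ j (suc m) 2
      (≡.trans (proj₁ (proj₂ pairs)) (≡.trans (length-applyUpTo suc _) (≡.sym (ℕ.*-suc 2 m))))

-- (a , b) stands for a + bθ in ℤ[θ] with θ² = α + βθ.
module QuadraticOrder (α β : ℤ) where

  open import Data.Integer using (_+_; _-_; _*_; -_)

  infixl 6 _⊕_
  infixl 7 _⊗_

  _⊕_ : Elt → Elt → Elt
  (a , b) ⊕ (c , d) = (a + c , b + d)

  _⊗_ : Elt → Elt → Elt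
  (a , b) ⊗ (c , d) = (a * c + α * (b * d) , a * d + b * c + β * (b * d))

  ι : ℤ → Elt
  ι a = (a , + 0)

  0ᴱ 1ᴱ θ : Elt
  0ᴱ = ι (+ 0)
  1ᴱ = ι (+ 1)
  θ  = (+ 0 , + 1)

  conj : Elt → Elt
  conj (a , b) = (a + β * b , - b)

  nrm : Elt → ℤ
  nrm (a , b) = a * a + β * (a * b) - α * (b * b)

  Δ : ℤ
  Δ = β * β + + 4 * α

  ⊕-assoc : ∀ x y z → (x ⊕ y) ⊕ z ≡ x ⊕ (y ⊕ z)
  ⊕-assoc (a , b) (c , d) (e , f) = cong₂ _,_ (ℤ.+-assoc a c e) (ℤ.+-assoc b d f)

  ⊕-comm : ∀ x y → x ⊕ y ≡ y ⊕ x
  ⊕-comm (a , b) (c , d) = cong₂ _,_ (ℤ.+-comm a c) (ℤ.+-comm b d)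

  ⊕-identityˡ : ∀ x → 0ᴱ ⊕ x ≡ x
  ⊕-identityˡ (a , b) = cong₂ _,_ (ℤ.+-identityˡ a) (ℤ.+-identityˡ b)

  ι-⊗ : ∀ c a b → ι c ⊗ (a , b) ≡ (c * a , c * b)
  ι-⊗ c a b = cong₂ _,_ (fst α c a b) (snd β c a b)
    where
    fst : ∀ α c a b → c * a + α * (+ 0 * b) ≡ c * a
    fst = solve-∀
    snd : ∀ β c a b → c * b + + 0 * a + β * (+ 0 * b) ≡ c * b
    snd = solve-∀

  ⊗-identityˡ : ∀ x → 1ᴱ ⊗ x ≡ x
  ⊗-identityˡ (a , b) = ≡.trans (ι-⊗ (+ 1) a b) (cong₂ _,_ (ℤ.*-identityˡ a) (ℤ.*-identityˡ b))

  ⊗-zeroˡ : ∀ x → 0ᴱ ⊗ x ≡ 0ᴱ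
  ⊗-zeroˡ (a , b) = ι-⊗ (+ 0) a b

  ⊗-comm : ∀ x y → x ⊗ y ≡ y ⊗ x
  ⊗-comm (a , b) (c , d) = cong₂ _,_ (fst α a b c d) (snd β a b c d)
    where
    fst : ∀ α a b c d → a * c + α * (b * d) ≡ c * a + α * (d * b)
    fst = solve-∀
    snd : ∀ β a b c d → a * d + b * c + β * (b * d) ≡ c * b + d * a + β * (d * b)
    snd = solve-∀

  ⊗-assoc : ∀ x y z → (x ⊗ y) ⊗ z ≡ x ⊗ (y ⊗ z)
  ⊗-assoc (a , b) (c , d) (e , f) = cong₂ _,_ (fst α β a b c d e f) (snd α β a b c d e f)
    where
    fst : ∀ α β a b c d e f →
      (a * c + α * (b * d)) * e + α * ((a * d + b * c + β * (b * d)) * f) ≡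
      a * (c * e + α * (d * f)) + α * (b * (c * f + d * e + β * (d * f)))
    fst = solve-∀
    snd : ∀ α β a b c d e f →
      (a * c + α * (b * d)) * f + (a * d + b * c + β * (b * d)) * e + β * ((a * d + b * c + β * (b * d)) * f) ≡
      a * (c * f + d * e + β * (d * f)) + b * (c * e + α * (d * f)) + β * (b * (c * f + d * e + β * (d * f)))
    snd = solve-∀

  ⊗-distribʳ : ∀ x y z → (y ⊕ z) ⊗ x ≡ y ⊗ x ⊕ z ⊗ x
  ⊗-distribʳ (a , b) (c , d) (e , f) = cong₂ _,_ (fst α a b c d e f) (snd β a b c d e f)
    where
    fst : ∀ α a b c d e f → (c + e) * a + α * ((d + f) * b) ≡ c * a + α * (d * b) + (e * a + α * (f * b))
    fst = solve-∀
    snd : ∀ β a b c d e f →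
      (c + e) * b + (d + f) * a + β * ((d + f) * b) ≡ c * b + d * a + β * (d * b) + (e * b + f * a + β * (f * b))
    snd = solve-∀

  ⊗-conj : ∀ x → x ⊗ conj x ≡ ι (nrm x)
  ⊗-conj (a , b) = cong₂ _,_ (fst α β a b) (snd β a b)
    where
    fst : ∀ α β a b → a * (a + β * b) + α * (b * - b) ≡ a * a + β * (a * b) - α * (b * b)
    fst = solve-∀
    snd : ∀ β a b → a * - b + b * (a + β * b) + β * (b * - b) ≡ + 0
    snd = solve-∀

  module Modulo (n : ℕ) where

    open Congruence n

    infix 4 _≋_
    record _≋_ (x y : Elt) : Set where
      constructor mk≋
      field
        proj₁∼ : proj₁ x ∼ proj₁ y
        proj₂∼ : proj₂ x ∼ proj₂ y

    ≡⇒≋ : ∀ {x y} → x ≡ y → x ≋ y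
    ≡⇒≋ refl = mk≋ ∼-refl ∼-refl

    ≋-refl : ∀ {x} → x ≋ x
    ≋-refl = ≡⇒≋ refl

    ≋-sym : ∀ {x y} → x ≋ y → y ≋ x
    ≋-sym (mk≋ p q) = mk≋ (∼-sym p) (∼-sym q)

    ≋-trans : ∀ {x y z} → x ≋ y → y ≋ z → x ≋ z
    ≋-trans (mk≋ p q) (mk≋ r s) = mk≋ (∼-trans p r) (∼-trans q s)

    ≋-isEquivalence : IsEquivalence _≋_
    ≋-isEquivalence = record { refl = ≋-refl ; sym = ≋-sym ; trans = ≋-trans }

    ≋-setoid : Setoid _ _
    ≋-setoid = record { isEquivalence = ≋-isEquivalence }

    ≋⇒≈[mod] : ∀ {x y} → x ≋ y → x ≈ y [mod n ]
    ≋⇒≈[mod] (mk≋ p q) = ∼⇒≡ᵢ p , ∼⇒≡ᵢ q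

    ι-cong : ∀ {a b} → a ∼ b → ι a ≋ ι b
    ι-cong a∼b = mk≋ a∼b ∼-refl

    ⊕-cong : ∀ {x y u v} → x ≋ y → u ≋ v → x ⊕ u ≋ y ⊕ v
    ⊕-cong {_ , _} {_ , _} {_ , _} {_ , _} (mk≋ p q) (mk≋ r s) = mk≋ (+-cong p r) (+-cong q s)

    ⊗-cong : ∀ {x y u v} → x ≋ y → u ≋ v → x ⊗ u ≋ y ⊗ v
    ⊗-cong {_ , _} {_ , _} {_ , _} {_ , _} (mk≋ p q) (mk≋ r s) =
      mk≋ (+-cong (*-cong p r) (*-cong (∼-refl {α}) (*-cong q s)))
          (+-cong (+-cong (*-cong p s) (*-cong q r)) (*-cong (∼-refl {β}) (*-cong q s)))

    isCommutativeSemiring : IsCommutativeSemiring _≋_ _⊕_ _⊗_ 0ᴱ 1ᴱ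
    isCommutativeSemiring = Biased.isCommutativeSemiringˡ record
      { +-isCommutativeMonoid = commutativeMonoid _⊕_ 0ᴱ ⊕-cong ⊕-assoc ⊕-identityˡ ⊕-comm
      ; *-isCommutativeMonoid = commutativeMonoid _⊗_ 1ᴱ ⊗-cong ⊗-assoc ⊗-identityˡ ⊗-comm
      ; distribʳ              = λ x y z → ≡⇒≋ (⊗-distribʳ x y z)
      ; zeroˡ                 = ≡⇒≋ ∘ ⊗-zeroˡ
      }
      where
      commutativeMonoid : ∀ _∙_ e →
        (∀ {x y u v} → x ≋ y → u ≋ v → (x ∙ u) ≋ (y ∙ v)) →
        (∀ x y z → ((x ∙ y) ∙ z) ≡ (x ∙ (y ∙ z))) →
        (∀ x → (e ∙ x) ≡ x) →
        (∀ x y → (x ∙ y) ≡ (y ∙ x)) →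
        IsCommutativeMonoid _≋_ _∙_ e
      commutativeMonoid _ _ ∙-cong assoc identityˡ comm = Biased.isCommutativeMonoidˡ record
        { isSemigroup = record
          { isMagma = record { isEquivalence = ≋-isEquivalence ; ∙-cong = ∙-cong }
          ; assoc   = λ x y z → ≡⇒≋ (assoc x y z)
          }
        ; identityˡ = ≡⇒≋ ∘ identityˡ
        ; comm      = λ x y → ≡⇒≋ (comm x y)
        }

    commutativeSemiring : CommutativeSemiring _ _
    commutativeSemiring = record { isCommutativeSemiring = isCommutativeSemiring }

    open CommutativeSemiring commutativeSemiring using (semiring)
    open import Algebra.Properties.Semiring.Exp semiring using (_^_)
    import Algebra.Properties.Semiring.Mult semiring as Mult

    ×≡*-pair : ∀ k a b → k Mult.× (a , b) ≡ (+ k * a , + k * b)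
    ×≡*-pair zero    a b = refl
    ×≡*-pair (suc k) a b =
      ≡.trans (cong ((a , b) ⊕_) (×≡*-pair k a b)) (cong₂ _,_ (a+ka≡[1+k]a (+ k) a) (a+ka≡[1+k]a (+ k) b))
      where
      a+ka≡[1+k]a : ∀ k a → a + k * a ≡ (+ 1 + k) * a
      a+ka≡[1+k]a = solve-∀

    n×x≋0 : ∀ x → n Mult.× x ≋ 0ᴱ
    n×x≋0 (a , b) = ≋-trans (≡⇒≋ (×≡*-pair n a b)) (mk≋ (n*c∼0 a) (n*c∼0 b))
      where
      n*c∼0 : ∀ c → + n * c ∼ + 0
      n*c∼0 c = ∼-by c (≡.trans (ℤ.+-identityʳ (+ n * c)) (ℤ.*-comm (+ n) c))

    ι[+k]≡k×1ᴱ : ∀ k → ι (+ k) ≡ k Mult.× 1ᴱ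
    ι[+k]≡k×1ᴱ zero    = refl
    ι[+k]≡k×1ᴱ (suc k) = cong (1ᴱ ⊕_) (ι[+k]≡k×1ᴱ k)

    ι-^ : ∀ a j → ι a ^ j ≡ ι (a ℤ.^ j)
    ι-^ a zero    = refl
    ι-^ a (suc j) = ≡.trans (cong (ι a ⊗_) (ι-^ a j))
      (≡.trans (ι-⊗ a (a ℤ.^ j) (+ 0)) (cong (a * a ℤ.^ j ,_) (ℤ.*-zeroʳ a)))

module InertPrime (p : ℕ) (p-prime : Prime p) (m : ℕ) (p≡3+2m : p ≡ 3 ℕ.+ 2 ℕ.* m)
                  (α β : ℤ) (Δ-nonresidue : Congruence.Nonresidue p (QuadraticOrder.Δ α β)) where

  open import Data.Integer using (_+_; _-_; _*_; -_)
  open OddPrime p p-prime m p≡3+2m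
  open QuadraticOrder α β
  open Modulo p
  open CommutativeSemiring commutativeSemiring using (semiring; *-identityʳ)
  open import Algebra.Properties.CommutativeSemiring.Exp commutativeSemiring using (^-distrib-*)
  open import Algebra.Properties.Semiring.Exp semiring using (_^_; ^-congˡ; ^-assocʳ)
  import Algebra.Properties.Semiring.Mult semiring as Mult
  open CharacteristicPrime commutativeSemiring using (^p-homo-+; [n×1#]^p≈n×1#)
  open import Relation.Binary.Reasoning.Setoid ≋-setoid

  fermat : ∀ a → ι a ^ p ≋ ι a
  fermat a = begin
    ι a ^ p            ≈⟨ ^-congˡ p (ι-cong (x∼x%ℕp a)) ⟩
    ι (+ r) ^ p        ≡⟨ cong (_^ p) (ι[+k]≡k×1ᴱ r) ⟩
    (r Mult.× 1ᴱ) ^ p  ≈⟨ [n×1#]^p≈n×1# p-prime n×x≋0 r ⟩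
    r Mult.× 1ᴱ        ≡⟨ ι[+k]≡k×1ᴱ r ⟨
    ι (+ r)            ≈⟨ ι-cong (∼-sym (x∼x%ℕp a)) ⟩
    ι a                ∎
    where r = a %ℕ p

  ι-cancel : ∀ {c x y} → c ≁ + 0 → ι c ⊗ x ≋ ι c ⊗ y → x ≋ y
  ι-cancel {c} {a , b} {a′ , b′} c≁0 cx≋cy
    with ≋-trans (≡⇒≋ (≡.sym (ι-⊗ c a b))) (≋-trans cx≋cy (≡⇒≋ (ι-⊗ c a′ b′)))
  ... | mk≋ ca∼ca′ cb∼cb′ = mk≋ (*-cancelˡ-∼ c≁0 ca∼ca′) (*-cancelˡ-∼ c≁0 cb∼cb′)

  δ : Elt
  δ = (- β , + 2)

  δ⊗δ≡ιΔ : δ ⊗ δ ≡ ι Δ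
  δ⊗δ≡ιΔ = cong₂ _,_ (fst α β) (snd β)
    where
    fst : ∀ α β → - β * - β + α * (+ 2 * + 2) ≡ β * β + + 4 * α
    fst = solve-∀
    snd : ∀ β → - β * + 2 + + 2 * - β + β * (+ 2 * + 2) ≡ + 0
    snd = solve-∀

  δ^p≋-δ : δ ^ p ≋ (β , - + 2)
  δ^p≋-δ = begin
    δ ^ p                  ≡⟨ cong (δ ^_) (≡.trans p≡3+2m (cong suc (≡.sym (ℕ.*-suc 2 m)))) ⟩
    δ ⊗ δ ^ (2 ℕ.* suc m)  ≈⟨ ⊗-cong (≋-refl {δ}) (^-assocʳ δ 2 (suc m)) ⟨
    δ ⊗ (δ ^ 2) ^ suc m    ≈⟨ ⊗-cong (≋-refl {δ}) (^-congˡ (suc m) δ^2≋δ⊗δ) ⟩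
    δ ⊗ (δ ⊗ δ) ^ suc m    ≡⟨ cong (λ y → δ ⊗ y ^ suc m) δ⊗δ≡ιΔ ⟩
    δ ⊗ ι Δ ^ suc m        ≡⟨ cong (δ ⊗_) (ι-^ Δ (suc m)) ⟩
    δ ⊗ ι (Δ ℤ.^ suc m)    ≈⟨ ⊗-cong (≋-refl {δ}) (ι-cong (euler-criterion Δ-nonresidue)) ⟩
    δ ⊗ ι (- + 1)          ≡⟨ cong₂ _,_ (fst α β) (snd β) ⟩
    (β , - + 2)            ∎
    where
    δ^2≋δ⊗δ = ⊗-cong (≋-refl {δ}) (*-identityʳ δ)
    fst : ∀ α β → - β * - + 1 + α * (+ 2 * + 0) ≡ β
    fst = solve-∀
    snd : ∀ β → - β * + 0 + + 2 * - + 1 + β * (+ 2 * + 0) ≡ - + 2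
    snd = solve-∀

  -- 2θ = δ + β, where δ² = Δ and hence δ^p = δ Δ^((p−1)/2) = −δ.
  θ^p≋conjθ : θ ^ p ≋ conj θ
  θ^p≋conjθ = ι-cancel 2≁0 (begin
    ι (+ 2) ⊗ θ ^ p      ≈⟨ ⊗-cong (fermat (+ 2)) (≋-refl {θ ^ p}) ⟨
    ι (+ 2) ^ p ⊗ θ ^ p  ≈⟨ ^-distrib-* (ι (+ 2)) θ p ⟨
    (ι (+ 2) ⊗ θ) ^ p    ≡⟨ cong (_^ p) 2θ≡δ+β ⟩
    (δ ⊕ ι β) ^ p        ≈⟨ ^p-homo-+ p-prime n×x≋0 δ (ι β) ⟩
    δ ^ p ⊕ ι β ^ p      ≈⟨ ⊕-cong δ^p≋-δ (fermat β) ⟩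
    (β , - + 2) ⊕ ι β    ≡⟨ 2conjθ≡-δ+β ⟨
    ι (+ 2) ⊗ conj θ     ∎)
    where
    2θ≡δ+β : ι (+ 2) ⊗ θ ≡ δ ⊕ ι β
    2θ≡δ+β = ≡.trans (ι-⊗ (+ 2) (+ 0) (+ 1)) (cong (_, + 2) (≡.sym (ℤ.+-inverseˡ β)))
    2conjθ≡-δ+β : ι (+ 2) ⊗ conj θ ≡ (β , - + 2) ⊕ ι β
    2conjθ≡-δ+β = ≡.trans (ι-⊗ (+ 2) (+ 0 + β * + 1) (- + 1)) (cong (_, - + 2) (2[0+β]≡β+β β))
      where
      2[0+β]≡β+β : ∀ β → + 2 * (+ 0 + β * + 1) ≡ β + β
      2[0+β]≡β+β = solve-∀

  frobenius : ∀ x → x ^ p ≋ conj x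
  frobenius (a , b) = begin
    (a , b) ^ p              ≡⟨ cong (_^ p) a+bθ ⟩
    (ι a ⊕ ι b ⊗ θ) ^ p      ≈⟨ ^p-homo-+ p-prime n×x≋0 (ι a) (ι b ⊗ θ) ⟩
    ι a ^ p ⊕ (ι b ⊗ θ) ^ p  ≈⟨ ⊕-cong (fermat a) (^-distrib-* (ι b) θ p) ⟩
    ι a ⊕ ι b ^ p ⊗ θ ^ p    ≈⟨ ⊕-cong (≋-refl {ι a}) (⊗-cong (fermat b) θ^p≋conjθ) ⟩
    ι a ⊕ ι b ⊗ conj θ       ≡⟨ a+bθ̄ ⟨
    conj (a , b)             ∎
    where
    a+bθ : (a , b) ≡ ι a ⊕ ι b ⊗ θ
    a+bθ = cong₂ _,_ (fst α a b) (snd β a b)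
      where
      fst : ∀ α a b → a ≡ a + (b * + 0 + α * (+ 0 * + 1))
      fst = solve-∀
      snd : ∀ β a b → b ≡ + 0 + (b * + 1 + + 0 * + 0 + β * (+ 0 * + 1))
      snd = solve-∀
    a+bθ̄ : conj (a , b) ≡ ι a ⊕ ι b ⊗ conj θ
    a+bθ̄ = cong₂ _,_ (fst α β a b) (snd β a b)
      where
      fst : ∀ α β a b → a + β * b ≡ a + (b * (+ 0 + β * + 1) + α * (+ 0 * - + 1))
      fst = solve-∀
      snd : ∀ β a b → - b ≡ + 0 + (b * - + 1 + + 0 * (+ 0 + β * + 1) + β * (+ 0 * - + 1))
      snd = solve-∀

  x^[1+p]≋ιnrm : ∀ x → x ^ suc p ≋ ι (nrm x)
  x^[1+p]≋ιnrm x = ≋-trans (⊗-cong (≋-refl {x}) (frobenius x)) (≡⇒≋ (⊗-conj x))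

  private
    [Δb]²∼4Δ : ∀ {a b} → a * a + α * (b * b) ∼ + 1 → + 2 * a + β * b ∼ + 0 →
               (Δ * b) * (Δ * b) ∼ + 4 * Δ
    [Δb]²∼4Δ {a} {b} a²+αb²∼1 2a+βb∼0 = ∼-trans (≡⇒∼ (expand α β a b)) (∼-trans
      (+-cong (*-cong (∼-refl {Δ}) (*-cong (∼-refl {+ 4}) a²+αb²∼1))
              (-‿cong (*-cong (∼-refl {Δ}) (*-cong 2a+βb∼0 (∼-refl {+ 2 * a - β * b})))))
      (≡⇒∼ (collapse Δ (+ 2 * a - β * b))))
      where
      expand : ∀ α β a b → (β * β + + 4 * α) * b * ((β * β + + 4 * α) * b) ≡
        (β * β + + 4 * α) * (+ 4 * (a * a + α * (b * b)))
          - (β * β + + 4 * α) * ((+ 2 * a + β * b) * (+ 2 * a - β * b))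
      expand = solve-∀
      collapse : ∀ Δ c → Δ * (+ 4 * + 1) - Δ * (+ 0 * c) ≡ + 4 * Δ
      collapse = solve-∀

  -- (a + bθ)² ≡ 1 gives b (2a + βb) ≡ 0, and 2a + βb ≡ 0 would make 4Δ ≡ (Δb)² a square.
  x⊗x≋1⇒x≋±1 : ∀ x → x ⊗ x ≋ 1ᴱ → x ≋ 1ᴱ ⊎ x ≋ ι (- + 1)
  x⊗x≋1⇒x≋±1 (a , b) (mk≋ a²+αb²∼1 2ab+βb²∼0)
    with x*y∼0⇒x∼0⊎y∼0 (∼-trans (≡⇒∼ (factor β a b)) 2ab+βb²∼0)
    where
    factor : ∀ β a b → b * (+ 2 * a + β * b) ≡ a * b + b * a + β * (b * b)
    factor = solve-∀
  ... | inj₁ b∼0 = Sum.map (λ a∼1 → mk≋ a∼1 b∼0) (λ a∼-1 → mk≋ a∼-1 b∼0) (x*x∼1⇒x∼±1 a²∼1)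
    where
    a²∼1 : a * a ∼ + 1
    a²∼1 = ∼-trans (≡⇒∼ (pad α a)) (∼-trans
      (+-cong (∼-refl {a * a}) (*-cong (∼-refl {α}) (*-cong (∼-sym b∼0) (∼-sym b∼0))))
      a²+αb²∼1)
      where
      pad : ∀ α a → a * a ≡ a * a + α * (+ 0 * + 0)
      pad = solve-∀
  ... | inj₂ 2a+βb∼0 = ⊥-elim (4*-nonresidue Δ-nonresidue (Δ * b) ([Δb]²∼4Δ {a} {b} a²+αb²∼1 2a+βb∼0))

  norm-one⇒strong-test : ∀ {x} s u → p ℕ.+ 1 ≡ 2 ℕ.^ s ℕ.* u → nrm x ∼ + 1 →
    x ^ u ≋ 1ᴱ ⊎ ∃ λ r → r ℕ.< s × x ^ (2 ℕ.^ r ℕ.* u) ≋ ι (- + 1)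
  norm-one⇒strong-test {x} s u p+1≡2ˢu nrm∼1 =
    ^-2-power-descent semiring (ι (- + 1)) x⊗x≋1⇒x≋±1 s (begin
      x ^ (2 ℕ.^ s ℕ.* u)  ≡⟨ cong (x ^_) (≡.trans (≡.sym p+1≡2ˢu) (ℕ.+-comm p 1)) ⟩
      x ^ suc p            ≈⟨ x^[1+p]≋ιnrm x ⟩
      ι (nrm x)            ≈⟨ ι-cong nrm∼1 ⟩
      1ᴱ                   ∎)

record Presentation (D : ℤ) : Set where
  field
    α β      : ℤ
    mul≡⊗    : ∀ x y → mul D x y ≡ QuadraticOrder._⊗_ α β x y
    norm≡nrm : ∀ x → norm D x ≡ QuadraticOrder.nrm α β x
    Δ≡D⊎4D   : QuadraticOrder.Δ α β ≡ D ⊎ QuadraticOrder.Δ α β ≡ + 4 ℤ.* D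

isOneMod4-cases : ∀ D → (D %ℕ 4 ≡ 1 × isOneMod4 D ≡ true) ⊎ isOneMod4 D ≡ false
isOneMod4-cases D with D %ℕ 4
... | 0           = inj₂ refl
... | 1           = inj₁ (refl , refl)
... | suc (suc _) = inj₂ refl

module _ (D : ℤ) where

  open import Data.Integer using (_+_; _-_; _*_; -_)

  √D-presentation : isOneMod4 D ≡ false → Presentation D
  √D-presentation D≢1 = record
    { α        = D
    ; β        = + 0
    ; mul≡⊗    = λ { (a , b) (c , d) → mul≡⊗ a b c d }
    ; norm≡nrm = λ { (a , b) → norm≡nrm a b }
    ; Δ≡D⊎4D   = inj₂ (ℤ.+-identityˡ (+ 4 * D))
    }
    where
    mul≡⊗ : ∀ a b c d → mul D (a , b) (c , d) ≡ (a * c + D * (b * d) , a * d + b * c + + 0 * (b * d))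
    mul≡⊗ a b c d rewrite D≢1 = cong (a * c + D * (b * d) ,_) (pad a b c d)
      where
      pad : ∀ a b c d → a * d + b * c ≡ a * d + b * c + + 0 * (b * d)
      pad = solve-∀
    norm≡nrm : ∀ a b → norm D (a , b) ≡ a * a + + 0 * (a * b) - D * (b * b)
    norm≡nrm a b rewrite D≢1 = pad a b D
      where
      pad : ∀ a b D → a * a - D * (b * b) ≡ a * a + + 0 * (a * b) - D * (b * b)
      pad = solve-∀

  -- D = 1 + 4q, so both (D − 1)/4 = q and (1 − D)/4 = −q are exact.
  ω-presentation : D %ℕ 4 ≡ 1 → isOneMod4 D ≡ true → Presentation D
  ω-presentation D%4≡1 D≡1 = record
    { α        = q
    ; β        = + 1
    ; mul≡⊗    = λ { (a , b) (c , d) → mul≡⊗ a b c d }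
    ; norm≡nrm = λ { (a , b) → norm≡nrm a b }
    ; Δ≡D⊎4D   = inj₁ (≡.trans (1+4q≡1+q*4 q) (≡.sym D≡1+q*4))
    }
    where
    q = D ℤ./ℕ 4
    D≡1+q*4 : D ≡ + 1 + q * + 4
    D≡1+q*4 = ≡.trans (ℤ.a≡a%ℕn+[a/ℕn]*n D 4) (cong (λ r → + r + q * + 4) D%4≡1)
    1+4q≡1+q*4 : ∀ q → + 1 * + 1 + + 4 * q ≡ + 1 + q * + 4
    1+4q≡1+q*4 = solve-∀
    [D-1]/4≡q : (D - + 1) ℤ./ℕ 4 ≡ q
    [D-1]/4≡q = ≡.trans (cong (λ E → (E - + 1) ℤ./ℕ 4) D≡1+q*4)
                        (≡.trans (cong (ℤ._/ℕ 4) ([1+4q]-1≡4q q)) ([q*d]/ℕd≡q q 4))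
      where
      [1+4q]-1≡4q : ∀ q → (+ 1 + q * + 4) - + 1 ≡ q * + 4
      [1+4q]-1≡4q = solve-∀
    [1-D]/4≡-q : (+ 1 - D) ℤ./ℕ 4 ≡ - q
    [1-D]/4≡-q = ≡.trans (cong (λ E → (+ 1 - E) ℤ./ℕ 4) D≡1+q*4)
                         (≡.trans (cong (ℤ._/ℕ 4) (1-[1+4q]≡-4q q)) ([q*d]/ℕd≡q (- q) 4))
      where
      1-[1+4q]≡-4q : ∀ q → + 1 - (+ 1 + q * + 4) ≡ - q * + 4
      1-[1+4q]≡-4q = solve-∀
    mul≡⊗ : ∀ a b c d → mul D (a , b) (c , d) ≡ (a * c + q * (b * d) , a * d + b * c + + 1 * (b * d))
    mul≡⊗ a b c d rewrite D≡1 = cong₂ _,_ (cong (λ α → a * c + α * (b * d)) [D-1]/4≡q) (pad a b c d)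
      where
      pad : ∀ a b c d → a * d + b * c + b * d ≡ a * d + b * c + + 1 * (b * d)
      pad = solve-∀
    norm≡nrm : ∀ a b → norm D (a , b) ≡ a * a + + 1 * (a * b) - q * (b * b)
    norm≡nrm a b rewrite D≡1 = ≡.trans (cong (λ γ → a * a + a * b + γ * (b * b)) [1-D]/4≡-q) (pad a b q)
      where
      pad : ∀ a b q → a * a + a * b + - q * (b * b) ≡ a * a + + 1 * (a * b) - q * (b * b)
      pad = solve-∀

presentation : ∀ D → Presentation D
presentation D = Sum.[ Prod.uncurry (ω-presentation D) , √D-presentation D ]′ (isOneMod4-cases D)

module QuadraticStrongTest (N : ℕ) (N-prime : Prime N) (m : ℕ) (N≡3+2m : N ≡ 3 ℕ.+ 2 ℕ.* m)
                           (D : ℤ) (legendre : LegendreMinusOne D N) where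

  open Presentation (presentation D)
  open OddPrime N N-prime m N≡3+2m using (_∼_; Nonresidue; ∼⇒≡ᵢ; ≡ᵢ⇒∼; 4*-nonresidue)

  D-nonresidue : Nonresidue D
  D-nonresidue t t²∼D = proj₂ legendre (t , ∼⇒≡ᵢ t²∼D)

  Δ-nonresidue : Nonresidue (QuadraticOrder.Δ α β)
  Δ-nonresidue with Δ≡D⊎4D
  ... | inj₁ Δ≡D  = subst Nonresidue (≡.sym Δ≡D) D-nonresidue
  ... | inj₂ Δ≡4D = subst Nonresidue (≡.sym Δ≡4D) (4*-nonresidue D-nonresidue)

  open QuadraticOrder α β
  open Modulo N
  open import Algebra.Properties.Semiring.Exp (CommutativeSemiring.semiring commutativeSemiring) using (_^_)
  open InertPrime N N-prime m N≡3+2m α β Δ-nonresidue using (norm-one⇒strong-test)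

  pow≡^ : ∀ w k → pow D w k ≡ w ^ k
  pow≡^ w zero    = refl
  pow≡^ w (suc k) = ≡.trans (mul≡⊗ w (pow D w k)) (cong (w ⊗_) (pow≡^ w k))

  private
    pow-≈[mod] : ∀ w k {y} → w ^ k ≋ y → pow D w k ≈ y [mod N ]
    pow-≈[mod] w k = ≋⇒≈[mod] ∘ ≋-trans (≡⇒≋ (pow≡^ w k))

  strong-test : ∀ s u → N ℕ.+ 1 ≡ 2 ℕ.^ s ℕ.* u → ∀ w → InG N D w →
    (pow D w u ≈ one [mod N ]) ⊎ (∃ λ r → r ℕ.< s × pow D w (2 ℕ.^ r ℕ.* u) ≈ minusOne [mod N ])
  strong-test s u N+1≡2ˢu w w∈G =
    Sum.map (pow-≈[mod] w u) (Prod.map₂ λ {r} → Prod.map₂ (pow-≈[mod] w (2 ℕ.^ r ℕ.* u)))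
      (norm-one⇒strong-test s u N+1≡2ˢu (subst (_∼ + 1) (norm≡nrm w) (≡ᵢ⇒∼ w∈G)))

-- Opened only here: unqualified, ℕ's operators would clash with the semiring operators above.
open import Data.Nat using (_<_; _≥_; _^_; _*_; _+_)
open import Data.Nat.Divisibility using (_∣_)
open import Defs using (SquareFree)

theorem1p4 : (N : ℕ) → Prime N → ¬ (2 ∣ N) →
    (D : ℤ) → D ≢ + 1 → SquareFree D → LegendreMinusOne D N →
    (s u : ℕ) → s ≥ 1 → ¬ (2 ∣ u) → N + 1 ≡ 2 ^ s * u →
    (w : Elt) → InG N D w →
    ¬ (w ≈ one [mod N ]) → ¬ (w ≈ minusOne [mod N ]) →
    (pow D w u ≈ one [mod N ])
      ⊎ (∃ λ (r : ℕ) → r < s × pow D w (2 ^ r * u) ≈ minusOne [mod N ])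
theorem1p4 N N-prime N-odd D _ _ legendre s u _ _ N+1≡2ˢu w w∈G _ _
  with odd>1⇒≡3+2m N (prime>1 N-prime) N-odd
... | m , N≡3+2m = QuadraticStrongTest.strong-test N N-prime m N≡3+2m D legendre s u N+1≡2ˢu w w∈G
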